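{- Let $\mathcal{P}\in\mathcal{Q}_n$ be an irreducible combinatorially symmetric sign pattern with a $0$-diagonal, with signed undirected graph $G$ and signed directed graph $D$. Suppose that $G$ has exactly one cycle $\mathcal{C}=u_1u_2\cdots u_k$ and that the distance from $\mathcal{C}$ to every leaf of $G$ is even. Then the maximum length of a composite cycle in $D$ equals $k$ plus the maximum length of a composite cycle in $D\setminus V(\mathcal{C})$ (the latter taken to be $0$ if $D\setminus V(\mathcal{C})$ contains no composite cycle).
   Context: A sign pattern of order $n$ is an $n\times n$ matrix $\mathcal{P}=[p_{ij}]$ with entries in $\{+,-,0\}$; $\mathcal{Q}_n$ is the set of all such patterns. $\mathcal{P}$ has a $0$-diagonal if all $p_{ii}=0$; it is combinatorially symmetric if $p_{ij}\ne0\iff p_{ji}\ne0$. The signed undirected graph $G$ has vertices $1,\dots,n$ and an edge $\{i,j\}$ ($i\ne j$) whenever $p_{ij}\ne0$; irreducibility means $G$ is connected. The signed directed graph $D$ has vertices $1,\dots,n$ and an arc $(i,j)$ whenever $p_{ij}\ne0$. A cycle of $G$ is a simple cycle of length at least $3$; a leaf is a vertex of degree $1$; $\operatorname{dist}(u,v)$ is the length of a shortest path between $u$ and $v$ in $G$, and $\operatorname{dist}(u,\mathcal{C})=\min_i \operatorname{dist}(u,u_i)$. A simple cycle of $D$ of length $k$ is a product $p_{i_1i_2}\cdots p_{i_ki_1}$ of nonzero entries with distinct indices; a composite cycle is a product of mutually vertex-disjoint simple cycles, and its length is the sum of their lengths. For a vertex set $S$, $D\setminus S$ is $D$ with the vertices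 of $S$ and their incident arcs deleted. -}

module Defs where

open import Data.Nat using (ℕ; zero; suc; _+_; _≤_)
open import Data.Nat.Properties using (_≟_)
open import Data.Nat.Divisibility using (_∣_)
open import Data.Fin using (Fin; toℕ; lower₁) renaming (zero to fzero; suc to fsuc)
open import Data.List using (List; []; _∷_; map)
open import Data.Nat.ListAction using (sum)
open import Data.Empty using (⊥)
open import Data.List.Relation.Unary.All using (All)
open import Data.List.Relation.Unary.AllPairs using (AllPairs)
open import Data.Product using (Σ; ∃; _×_; _,_)
open import Data.Sum using (_⊎_)
open import Relation.Nullary using (¬_; yes; no)
open import Relation.Binary.PropositionalEquality using (_≡_; _≢_; cong)
open import Function.Definitions using (Injective)

data Sign : Set where
  plus minus zero : Sign

SignPattern : ℕ → Set
SignPattern n = Fin n → Fin n → Sign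

module _ {n : ℕ} (P : SignPattern n) where

  NonZero : Fin n → Fin n → Set
  NonZero i j = P i j ≢ zero

  ZeroDiagonal : Set
  ZeroDiagonal = ∀ i → P i i ≡ zero

  CombSymmetric : Set
  CombSymmetric = ∀ i j → (NonZero i j → NonZero j i) × (NonZero j i → NonZero i j)

  -- edge {i,j} of the undirected graph G
  Adj : Fin n → Fin n → Set
  Adj i j = (i ≢ j) × NonZero i j

  data Walk : Fin n → Fin n → ℕ → Set where
    here : ∀ {u} → Walk u u 0
    step : ∀ {u w v l} → Adj u w → Walk w v l → Walk u v (suc l)

  -- irreducible: G connected
  Irreducible : Set
  Irreducible = ∀ u v → ∃ λ l → Walk u v l

  Leaf : Fin n → Set
  Leaf v = Σ (Fin n) λ w → Adj v w × (∀ w' → Adj v w' → w' ≡ w)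

NoVertex : ∀ {n} → Fin n → Set
NoVertex _ = ⊥

next : ∀ {m} → Fin (suc m) → Fin (suc m)
next {m} i with m ≟ toℕ i
... | yes _ = fzero
... | no ne = lower₁ (fsuc i) (λ e → ne (cong Data.Nat.pred e))

module _ {n : ℕ} (P : SignPattern n) where

  record GCycle : Set where
    field
      m      : ℕ
      long   : 3 ≤ suc m
      vert   : Fin (suc m) → Fin n
      inj    : Injective _≡_ _≡_ vert
      adj    : ∀ i → Adj P (vert i) (vert (next i))

  glen : GCycle → ℕ
  glen C = suc (GCycle.m C)

  CycleEdge : GCycle → Fin n → Fin n → Set
  CycleEdge C x y = ∃ λ i →
    (vert i ≡ x × vert (next i) ≡ y) ⊎ (vert i ≡ y × vert (next i) ≡ x)
    where open GCycle C

  -- two cycles are the same cycle (same edge set, as subgraphs of G)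
  SameCycle : GCycle → GCycle → Set
  SameCycle C C' = ∀ x y → (CycleEdge C x y → CycleEdge C' x y) × (CycleEdge C' x y → CycleEdge C x y)

  UniqueCycle : GCycle → Set
  UniqueCycle C = ∀ C' → SameCycle C' C

  OnCycle : GCycle → Fin n → Set
  OnCycle C v = ∃ λ i → GCycle.vert C i ≡ v

  DistToCycle : GCycle → Fin n → ℕ → Set
  DistToCycle C u d =
    (∃ λ i → Walk P u (GCycle.vert C i) d) × (∀ i l → Walk P u (GCycle.vert C i) l → d ≤ l)

  record DCycle : Set where
    field
      m      : ℕ
      vert   : Fin (suc m) → Fin n
      inj    : Injective _≡_ _≡_ vert
      arc    : ∀ i → NonZero P (vert i) (vert (next i))

  dlen : DCycle → ℕ
  dlen c = suc (DCycle.m c)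

  Disjoint : DCycle → DCycle → Set
  Disjoint c c' = ∀ i j → DCycle.vert c i ≢ DCycle.vert c' j

  -- composite cycle of D \ S: a nonempty list of mutually vertex-disjoint simple cycles of D
  -- none of which uses a vertex of S (cycles of D \ S are exactly such cycles of D)
  record CompositeCycleAvoiding (S : Fin n → Set) : Set where
    field
      c₀     : DCycle
      cs     : List DCycle
      disj   : AllPairs Disjoint (c₀ ∷ cs)
      avoid  : All (λ c → ∀ i → ¬ S (DCycle.vert c i)) (c₀ ∷ cs)

  ccLength : ∀ {S} → CompositeCycleAvoiding S → ℕ
  ccLength cc = sum (map dlen (c₀ ∷ cs))
    where open CompositeCycleAvoiding cc

  CompositeCycle : Set
  CompositeCycle = CompositeCycleAvoiding NoVertex

  IsMaxCCLength : (Fin n → Set) → ℕ → Set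
  IsMaxCCLength S M =
    (Σ (CompositeCycleAvoiding S) λ cc → ccLength cc ≡ M) ×
    (∀ (cc : CompositeCycleAvoiding S) → ccLength cc ≤ M)

  IsMaxCCLength0 : (Fin n → Set) → ℕ → Set
  IsMaxCCLength0 S M =
    (M ≡ 0 × ¬ CompositeCycleAvoiding S) ⊎ IsMaxCCLength S M

module Submission where

-- Let depth v be the distance from v to C. As C is the only cycle of G, removing the edges of C leaves
-- a forest hanging from C: adjacent vertices off C never have equal depth, and no vertex has two
-- neighbours of smaller depth, since otherwise the paths down to C would close a second cycle. So every
-- edge of G joins two vertices of C or has an endpoint of odd depth. A vertex of odd depth is not a leaf,
-- hence has a child, and the 2-cycles (v, child v) over odd v are disjoint and avoid C: 2·#odd ≤ M.
-- A composite cycle of D either contains a cycle of length ≥ 3, which is a cycle of G and hence C, the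
-- other cycles then avoiding C; or it consists of 2-cycles, i.e. is a matching of G, and counting the
-- vertices of C once and the odd vertices twice bounds its length by k + 2·#odd ≤ k + M. Conversely C
-- together with a longest composite cycle of D ∖ V(C) has length k + M.

open import Defs

open import Data.Nat using (ℕ; zero; suc; pred; _+_; _*_; _∸_; _≤_; _<_; _≤?_; z≤n; s≤s; s≤s⁻¹; z<s)
open import Data.Nat.Properties
  using ( _≟_; module ≤-Reasoning; +-comm; +-commutativeSemigroup; +-suc; +-identityʳ; *-suc; *-distribˡ-+
        ; ≤-refl; ≤-reflexive; ≤-trans; ≤-antisym; <⇒≤; <⇒≢; <⇒≱; ≰⇒>; ≤∧≢⇒<; <-cmp; n≢0⇒n>0; n≤0⇒n≡0
        ; 1+n≢0; 1+n≢n; 1+n≰n; suc-injective; m<n⇒m<1+n; m≤n⇒∃[o]m+o≡n; m≤m+n; m≤n+m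
        ; +-mono-≤; +-monoˡ-≤; +-monoʳ-≤; *-monoʳ-≤; +-cancelˡ-≤; +-cancelˡ-≡
        ; m∸n≤m; n∸n≡0; +-∸-assoc; ∸-monoʳ-<; ∸-cancelˡ-≡; m+[n∸m]≡n; pred[m∸n]≡m∸[1+n]; m<n⇒0<n∸m )
open import Algebra.Properties.CommutativeSemigroup +-commutativeSemigroup using (x∙yz≈y∙xz; interchange)
open import Data.Nat.Divisibility using (_∣_; _∣?_; _∣0; ∣-refl; ∣1⇒≡1; ∣m+n∣m⇒∣n; ∣m∣n⇒∣m+n)
open import Data.Nat.DivMod using (_mod_; m<n⇒m%n≡m)
open import Data.Nat.ListAction using (sum)
open import Data.Fin using (Fin; toℕ; fromℕ<) renaming (zero to fzero; suc to fsuc; _≟_ to _≟ᶠ_)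
open import Data.Fin.Properties
  using (any?; toℕ<n; toℕ≤pred[n]; toℕ-injective; toℕ-fromℕ<; toℕ-lower₁; injective⇒≤)
open import Data.List using (List; []; _∷_; _++_; map; length; filter; allFin; tabulate)
open import Data.List.Properties using (length-++; length-removeAt′; length-tabulate; filter-++; filter-all)
open import Data.List.Membership.Propositional using (_∈_)
open import Data.List.Membership.Propositional.Properties
  using (∈-length; ∈-filter⁺; ∈-filter⁻; ∈-tabulate⁺; ∈-allFin)
open import Data.List.Relation.Binary.Subset.Propositional using (_⊆_)
open import Data.List.Relation.Unary.Any as Any using (Any; here; there; _─_)
open import Data.List.Relation.Unary.Any.Properties using (lookup-result)
open import Data.List.Relation.Unary.All as All using (All; []; _∷_)
open import Data.List.Relation.Unary.All.Properties as All using (─⁺; all-filter; ¬Any⇒All¬)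
open import Data.List.Relation.Unary.AllPairs using (AllPairs; []; _∷_)
open import Data.List.Relation.Unary.Unique.Propositional using (Unique)
open import Data.List.Relation.Unary.Unique.Propositional.Properties using (filter⁺; allFin⁺)
open import Data.Product using (Σ; ∃-syntax; _×_; _,_; proj₁; proj₂)
open import Data.Sum using (_⊎_; inj₁; inj₂; swap)
open import Data.Empty using (⊥)
open import Function using (_∘_; const)
open import Function.Definitions using (Injective)
open import Relation.Nullary using (¬_; Dec; yes; no; contradiction; ¬?; _×-dec_; _⊎-dec_)
open import Relation.Nullary.Decidable using (map′; decidable-stable)
open import Relation.Unary using (Decidable)
open import Relation.Binary using (Rel; Symmetric; tri<; tri≈; tri>)
open import Relation.Binary.PropositionalEquality
  using (_≡_; _≢_; refl; sym; trans; cong; cong₂; subst; subst₂; ≢-sym; module ≡-Reasoning)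

least-witness : ∀ {q} {Q : ℕ → Set q} → Decidable Q → ∀ {m} → Q m →
                ∃[ d ] Q d × (∀ {l} → Q l → d ≤ l)
least-witness Q? qm with Q? 0
... | yes q0 = 0 , q0 , λ _ → z≤n
least-witness Q? {zero} q0 | no ¬q0 = contradiction q0 ¬q0
least-witness {Q = Q} Q? {suc m} qm | no ¬q0 with least-witness (λ l → Q? (suc l)) qm
... | d , qd , least = suc d , qd , least-suc
  where
    least-suc : ∀ {l} → Q l → suc d ≤ l
    least-suc {zero}  q0 = contradiction q0 ¬q0
    least-suc {suc l} ql = s≤s (least ql)

2∣n⇒2∤1+n : ∀ {k} → 2 ∣ k → ¬ 2 ∣ suc k
2∣n⇒2∤1+n {k} 2∣k 2∣1+k with ∣1⇒≡1 (∣m+n∣m⇒∣n (subst (2 ∣_) (+-comm 1 k) 2∣1+k) 2∣k)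
... | ()

2∤n⇒2∣1+n : ∀ k → ¬ 2 ∣ k → 2 ∣ suc k
2∤n⇒2∣1+n zero 2∤0 = contradiction (2 ∣0) 2∤0
2∤n⇒2∣1+n (suc zero) _ = ∣-refl
2∤n⇒2∣1+n (suc (suc k)) 2∤2+k = ∣m∣n⇒∣m+n ∣-refl (2∤n⇒2∣1+n k (λ 2∣k → 2∤2+k (∣m∣n⇒∣m+n ∣-refl 2∣k)))

module _ {a} {A : Set a} where

  ∈-─⁺ : ∀ {x y} {ys : List A} (x∈ys : x ∈ ys) → y ∈ ys → y ≢ x → y ∈ (ys ─ x∈ys)
  ∈-─⁺ (here refl) (here refl) y≢x = contradiction refl y≢x
  ∈-─⁺ (here refl) (there y∈ys) _ = y∈ys
  ∈-─⁺ (there x∈ys) (here refl) _ = here refl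
  ∈-─⁺ (there x∈ys) (there y∈ys) y≢x = there (∈-─⁺ x∈ys y∈ys y≢x)

  Unique⇒length≤ : ∀ {xs ys : List A} → Unique xs → xs ⊆ ys → length xs ≤ length ys
  Unique⇒length≤ [] _ = z≤n
  Unique⇒length≤ {ys = ys} (x∉xs ∷ unique-xs) xs⊆ys =
    subst (_ ≤_) (sym (length-removeAt′ ys (Any.index x∈ys))) (s≤s (Unique⇒length≤ unique-xs xs⊆ys─x))
    where
      x∈ys = xs⊆ys (here refl)
      xs⊆ys─x : _ ⊆ (ys ─ x∈ys)
      xs⊆ys─x y∈xs = ∈-─⁺ x∈ys (xs⊆ys (there y∈xs)) (All.lookup x∉xs y∈xs ∘ sym)

module _ {a p} {A : Set a} {P : A → Set p} (P? : Decidable P) where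

  length-filter-++ : ∀ xs ys → length (filter P? (xs ++ ys)) ≡ length (filter P? xs) + length (filter P? ys)
  length-filter-++ xs ys = trans (cong length (filter-++ P? xs ys)) (length-++ (filter P? xs))

module _ {a p r} {A : Set a} {P : A → Set p} {R : Rel A r} where

  AllPairs-─⁺ : ∀ {xs} (pxs : Any P xs) → AllPairs R xs → AllPairs R (xs ─ pxs)
  AllPairs-─⁺ (here _) (_ ∷ rs) = rs
  AllPairs-─⁺ (there pxs) (r ∷ rs) = All.─⁺ pxs r ∷ AllPairs-─⁺ pxs rs

  AllPairs⇒All-lookup-─ : Symmetric R → ∀ {xs} (pxs : Any P xs) → AllPairs R xs →
                          All (R (Any.lookup pxs)) (xs ─ pxs)
  AllPairs⇒All-lookup-─ R-sym (here _) (r ∷ _) = r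
  AllPairs⇒All-lookup-─ R-sym (there pxs) (r ∷ rs) =
    R-sym (proj₁ (All.lookupAny r pxs)) ∷ AllPairs⇒All-lookup-─ R-sym pxs rs

module _ {a p} {A : Set a} {P : A → Set p} (f : A → ℕ) where

  sum-map-─ : ∀ {xs} (pxs : Any P xs) → sum (map f xs) ≡ f (Any.lookup pxs) + sum (map f (xs ─ pxs))
  sum-map-─ (here _) = refl
  sum-map-─ {x ∷ xs} (there pxs) =
    trans (cong (f x +_) (sum-map-─ pxs)) (x∙yz≈y∙xz (f x) (f (Any.lookup pxs)) _)

toℕ-next : ∀ {m} (i : Fin (suc m)) →
           (toℕ i ≡ m × next i ≡ fzero) ⊎ (toℕ i < m × toℕ (next i) ≡ suc (toℕ i))
toℕ-next {m} i with m ≟ toℕ i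
... | yes m≡i = inj₁ (sym m≡i , refl)
... | no m≢i = inj₂ (≤∧≢⇒< (toℕ≤pred[n] i) (m≢i ∘ sym) , toℕ-lower₁ (fsuc i) (m≢i ∘ cong pred))

next-≢ : ∀ {m} → 1 ≤ m → (i : Fin (suc m)) → i ≢ next i
next-≢ 1≤m i i≡next with toℕ-next i
... | inj₁ (i≡m , next≡0) = contradiction (trans (sym i≡m) (cong toℕ (trans i≡next next≡0))) (≢-sym (<⇒≢ 1≤m))
... | inj₂ (_ , next≡1+i) = 1+n≢n (sym (trans (cong toℕ i≡next) next≡1+i))

≤-or-beyond : ∀ l k → k ≤ l ⊎ ∃[ t ] k ≡ l + suc t
≤-or-beyond l k with k ≤? l
... | yes k≤l = inj₁ k≤l
... | no k≰l with t , 1+l+t≡k ← m≤n⇒∃[o]m+o≡n (≰⇒> k≰l) = inj₂ (t , trans (sym 1+l+t≡k) (sym (+-suc l t)))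

module _ {a} {A : Set a} where

  splice : ℕ → (ℕ → A) → (ℕ → A) → ℕ → A
  splice zero    f g k       = g k
  splice (suc l) f g zero    = f zero
  splice (suc l) f g (suc k) = splice l (f ∘ suc) g k

  splice-≤ : ∀ l f g {k} → k ≤ l → f l ≡ g 0 → splice l f g k ≡ f k
  splice-≤ zero    f g z≤n       fl≡g0 = sym fl≡g0
  splice-≤ (suc l) f g {zero}  _ _     = refl
  splice-≤ (suc l) f g {suc k} (s≤s k≤l) fl≡g0 = splice-≤ l (f ∘ suc) g k≤l fl≡g0

  splice-+ : ∀ l f g t → splice l f g (l + t) ≡ g t
  splice-+ zero    f g t = refl
  splice-+ (suc l) f g t = splice-+ l (f ∘ suc) g t

isZero? : (s : Sign) → Dec (s ≡ zero)
isZero? plus  = no λ ()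
isZero? minus = no λ ()
isZero? zero  = yes refl

module _ {n : ℕ} (P : SignPattern n) where

  adj? : ∀ x y → Dec (Adj P x y)
  adj? x y = ¬? (x ≟ᶠ y) ×-dec ¬? (isZero? (P x y))

  -- Simple paths of G; only the values of vertex on 0 … len matter.
  record Path : Set where
    field
      len       : ℕ
      vertex    : ℕ → Fin n
      adjacent  : ∀ {i} → i < len → Adj P (vertex i) (vertex (suc i))
      injective : ∀ {i j} → i ≤ len → j ≤ len → vertex i ≡ vertex j → i ≡ j

    start end : Fin n
    start = vertex 0
    end   = vertex len

open Path public

module _ {n : ℕ} {P : SignPattern n} where

  infix 4 _∈ᵥ_
  _∈ᵥ_ : Fin n → Path P → Set
  v ∈ᵥ p = ∃[ i ] i ≤ len p × vertex p i ≡ v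

  start∈ᵥ : ∀ (p : Path P) → start p ∈ᵥ p
  start∈ᵥ p = 0 , z≤n , refl

  end∈ᵥ : ∀ (p : Path P) → end p ∈ᵥ p
  end∈ᵥ p = len p , ≤-refl , refl

  start≢end⇒1≤len : ∀ (p : Path P) → start p ≢ end p → 1 ≤ len p
  start≢end⇒1≤len p start≢end = ≤∧≢⇒< z≤n (start≢end ∘ cong (vertex p))

record PathBetween {n} (P : SignPattern n) (x y : Fin n) (Q : Fin n → Set) : Set where
  field
    path   : Path P
    starts : start path ≡ x
    ends   : end path ≡ y
    within : ∀ {v} → v ∈ᵥ path → Q v

module _ {n : ℕ} {P : SignPattern n} where

  point : Fin n → Path P
  point v = record
    { len = 0 ; vertex = λ _ → v ; adjacent = λ () ; injective = λ { z≤n z≤n _ → refl } }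

  edge : ∀ {x y} → Adj P x y → Path P
  edge {x} {y} (x≢y , x→y) = record
    { len = 1 ; vertex = endpoint ; adjacent = λ { (s≤s z≤n) → x≢y , x→y } ; injective = endpoint-inj }
    where
      endpoint : ℕ → Fin n
      endpoint zero    = x
      endpoint (suc _) = y
      endpoint-inj : ∀ {i j} → i ≤ 1 → j ≤ 1 → endpoint i ≡ endpoint j → i ≡ j
      endpoint-inj z≤n       z≤n       _   = refl
      endpoint-inj z≤n       (s≤s z≤n) x≡y = contradiction x≡y x≢y
      endpoint-inj (s≤s z≤n) z≤n       y≡x = contradiction (sym y≡x) x≢y
      endpoint-inj (s≤s z≤n) (s≤s z≤n) _   = refl

  module _ (p q : Path P) (end≡start : end p ≡ start q)
           (meet-at-start : ∀ {t} → t ≤ len q → vertex q t ∈ᵥ p → t ≡ 0) where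

    private
      J : ℕ → Fin n
      J = splice (len p) (vertex p) (vertex q)

      J-p : ∀ {k} → k ≤ len p → J k ≡ vertex p k
      J-p k≤ = splice-≤ (len p) (vertex p) (vertex q) k≤ end≡start

      J-q : ∀ {k t} → k ≡ len p + t → J k ≡ vertex q t
      J-q {t = t} refl = splice-+ (len p) (vertex p) (vertex q) t

      beyond-≤ : ∀ {k t} → k ≡ len p + suc t → k ≤ len p + len q → suc t ≤ len q
      beyond-≤ {t = t} refl k≤ = +-cancelˡ-≤ (len p) (suc t) (len q) k≤

      J-adj : ∀ {i} → i < len p + len q → Adj P (J i) (J (suc i))
      J-adj {i} i< with ≤-or-beyond (len p) (suc i)
      ... | inj₁ 1+i≤ = subst₂ (Adj P) (sym (J-p (<⇒≤ 1+i≤))) (sym (J-p 1+i≤)) (adjacent p 1+i≤)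
      ... | inj₂ (t , 1+i≡) = subst₂ (Adj P) (sym (J-q i≡)) (sym (J-q 1+i≡)) (adjacent q (beyond-≤ 1+i≡ i<))
        where i≡ = suc-injective (trans 1+i≡ (+-suc (len p) t))

      J-inj : ∀ {i j} → i ≤ len p + len q → j ≤ len p + len q → J i ≡ J j → i ≡ j
      J-inj {i} {j} i≤ j≤ Ji≡Jj with ≤-or-beyond (len p) i | ≤-or-beyond (len p) j
      ... | inj₁ i≤p | inj₁ j≤p = injective p i≤p j≤p (trans (sym (J-p i≤p)) (trans Ji≡Jj (J-p j≤p)))
      ... | inj₁ i≤p | inj₂ (_ , j≡) =
        contradiction (meet-at-start (beyond-≤ j≡ j≤) (i , i≤p , trans (sym (J-p i≤p)) (trans Ji≡Jj (J-q j≡))))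
                      λ ()
      ... | inj₂ (_ , i≡) | inj₁ j≤p =
        contradiction (meet-at-start (beyond-≤ i≡ i≤) (j , j≤p , trans (sym (J-p j≤p)) (trans (sym Ji≡Jj) (J-q i≡))))
                      λ ()
      ... | inj₂ (_ , i≡) | inj₂ (_ , j≡) =
        trans i≡ (trans (cong (len p +_) (injective q (beyond-≤ i≡ i≤) (beyond-≤ j≡ j≤) q≡)) (sym j≡))
        where q≡ = trans (sym (J-q i≡)) (trans Ji≡Jj (J-q j≡))

    join : Path P
    join = record { len = len p + len q ; vertex = J ; adjacent = J-adj ; injective = J-inj }

    join-start : start join ≡ start p
    join-start = J-p z≤n

    join-end : end join ≡ end q
    join-end = J-q refl

    join-∈ᵥ : ∀ {v} → v ∈ᵥ join → v ∈ᵥ p ⊎ v ∈ᵥ q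
    join-∈ᵥ {v} (k , k≤ , Jk≡v) with ≤-or-beyond (len p) k
    ... | inj₁ k≤p = inj₁ (k , k≤p , trans (sym (J-p k≤p)) Jk≡v)
    ... | inj₂ (t , k≡) = inj₂ (suc t , beyond-≤ k≡ k≤ , trans (sym (J-q k≡)) Jk≡v)

module _ {n : ℕ} {P : SignPattern n} (csym : CombSymmetric P) where

  adj-sym : ∀ {x y} → Adj P x y → Adj P y x
  adj-sym (x≢y , x→y) = x≢y ∘ sym , proj₁ (csym _ _) x→y

  reverse : Path P → Path P
  reverse p = record
    { len = len p ; vertex = λ k → vertex p (len p ∸ k) ; adjacent = reverse-adj ; injective = reverse-inj }
    where
      reverse-adj : ∀ {i} → i < len p → Adj P (vertex p (len p ∸ i)) (vertex p (len p ∸ suc i))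
      reverse-adj {i} i<len =
        subst (λ k → Adj P (vertex p k) (vertex p (len p ∸ suc i))) (sym (+-∸-assoc 1 i<len))
              (adj-sym (adjacent p (∸-monoʳ-< z<s i<len)))
      reverse-inj : ∀ {i j} → i ≤ len p → j ≤ len p → vertex p (len p ∸ i) ≡ vertex p (len p ∸ j) → i ≡ j
      reverse-inj {i} {j} i≤ j≤ eq =
        ∸-cancelˡ-≡ i≤ j≤ (injective p (m∸n≤m (len p) i) (m∸n≤m (len p) j) eq)

  reverse-end : ∀ (p : Path P) → end (reverse p) ≡ start p
  reverse-end p = cong (vertex p) (n∸n≡0 (len p))

  reverse-∈ᵥ : ∀ {p : Path P} {v} → v ∈ᵥ reverse p → v ∈ᵥ p
  reverse-∈ᵥ {p} (k , _ , eq) = len p ∸ k , m∸n≤m (len p) k , eq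

  PathBetween-sym : ∀ {x y Q} → PathBetween P x y Q → PathBetween P y x Q
  PathBetween-sym π = record
    { path = reverse path ; starts = ends ; ends = trans (reverse-end path) starts
    ; within = within ∘ reverse-∈ᵥ {path} }
    where open PathBetween π

module _ {n : ℕ} {P : SignPattern n} where

  edges⊆⇒vertices⊆ : ∀ (C′ C : GCycle P) → (∀ x y → CycleEdge P C′ x y → CycleEdge P C x y) →
                     ∀ i → OnCycle P C (GCycle.vert C′ i)
  edges⊆⇒vertices⊆ C′ C E⊆E i with E⊆E _ _ (i , inj₁ (refl , refl))
  ... | j , inj₁ (vj≡ , _) = j , vj≡
  ... | j , inj₂ (_ , vnextj≡) = next j , vnextj≡

  closedPath→GCycle : (p : Path P) → 2 ≤ len p → Adj P (end p) (start p) → GCycle P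
  closedPath→GCycle p 2≤len end~start = record
    { m = len p ; long = s≤s 2≤len ; vert = vertex p ∘ toℕ
    ; inj = λ eq → toℕ-injective (injective p (toℕ≤pred[n] _) (toℕ≤pred[n] _) eq) ; adj = cyclic-adj }
    where
      cyclic-adj : ∀ (k : Fin (suc (len p))) → Adj P (vertex p (toℕ k)) (vertex p (toℕ (next k)))
      cyclic-adj k with toℕ-next k
      ... | inj₁ (k≡len , next≡0) =
        subst₂ (λ a b → Adj P (vertex p a) (vertex p b)) (sym k≡len) (sym (cong toℕ next≡0)) end~start
      ... | inj₂ (k<len , next≡1+k) =
        subst (Adj P (vertex p (toℕ k)) ∘ vertex p) (sym next≡1+k) (adjacent p k<len)

  GCycle→DCycle : GCycle P → DCycle P
  GCycle→DCycle C = record { m = m ; vert = vert ; inj = inj ; arc = proj₂ ∘ adj }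
    where open GCycle C

  DCycle→GCycle : (c : DCycle P) → 2 ≤ DCycle.m c → GCycle P
  DCycle→GCycle c 2≤m = record
    { m = m ; long = s≤s 2≤m ; vert = vert ; inj = inj
    ; adj = λ i → (λ eq → next-≢ (<⇒≤ 2≤m) i (inj eq)) , arc i }
    where open DCycle c

  Disjoint-sym : ∀ {c d : DCycle P} → Disjoint P c d → Disjoint P d c
  Disjoint-sym c∩c′=∅ i j eq = c∩c′=∅ j i (sym eq)

  Avoids : (Fin n → Set) → DCycle P → Set
  Avoids S c = ∀ i → ¬ S (DCycle.vert c i)

  ZeroDiagonal⇒1≤m : ZeroDiagonal P → (c : DCycle P) → 1 ≤ DCycle.m c
  ZeroDiagonal⇒1≤m zd record { m = zero ; vert = vert ; arc = arc } =
    contradiction (zd (vert fzero)) (arc fzero)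
  ZeroDiagonal⇒1≤m zd record { m = suc _ } = s≤s z≤n

  twoCycle : CombSymmetric P → ∀ {x y} → Adj P x y → DCycle P
  twoCycle csym {x} {y} x~y = record { m = 1 ; vert = endpoint ; inj = endpoint-inj ; arc = endpoint-arc }
    where
      endpoint : Fin 2 → Fin n
      endpoint fzero    = x
      endpoint (fsuc _) = y
      endpoint-inj : Injective _≡_ _≡_ endpoint
      endpoint-inj {fzero}      {fzero}      _   = refl
      endpoint-inj {fzero}      {fsuc fzero} x≡y = contradiction x≡y (proj₁ x~y)
      endpoint-inj {fsuc fzero} {fzero}      y≡x = contradiction (sym y≡x) (proj₁ x~y)
      endpoint-inj {fsuc fzero} {fsuc fzero} _   = refl
      endpoint-arc : ∀ i → NonZero P (endpoint i) (endpoint (next i))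
      endpoint-arc fzero        = proj₂ x~y
      endpoint-arc (fsuc fzero) = proj₂ (adj-sym csym x~y)

  DCycle-adj : (c : DCycle P) → 1 ≤ DCycle.m c → Adj P (DCycle.vert c fzero) (DCycle.vert c (next fzero))
  DCycle-adj c 1≤m = (λ eq → next-≢ 1≤m fzero (DCycle.inj c eq)) , DCycle.arc c fzero

  endpoints : List (DCycle P) → List (Fin n)
  endpoints []       = []
  endpoints (c ∷ cs) = DCycle.vert c fzero ∷ DCycle.vert c (next fzero) ∷ endpoints cs

  endpoints-unique : ∀ {cs} → All (λ c → 1 ≤ DCycle.m c) cs → AllPairs (Disjoint P) cs →
                     Unique (endpoints cs)
  endpoints-unique []                  []               = []
  endpoints-unique {c ∷ _} (1≤m ∷ 1≤ms) (c-disj ∷ disj) =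
    (proj₁ (DCycle-adj c 1≤m) ∷ not-in fzero c-disj) ∷ not-in (next fzero) c-disj ∷ endpoints-unique 1≤ms disj
    where
      not-in : ∀ i {ds} → All (Disjoint P c) ds → All (DCycle.vert c i ≢_) (endpoints ds)
      not-in i []             = []
      not-in i (c∩d=∅ ∷ rest) = c∩d=∅ i fzero ∷ c∩d=∅ i (next fzero) ∷ not-in i rest

  sum-dlen-2-cycles : ∀ {cs} → All (λ c → DCycle.m c ≡ 1) cs → sum (map (dlen P) cs) ≡ 2 * length cs
  sum-dlen-2-cycles []                    = refl
  sum-dlen-2-cycles {_ ∷ cs} (m≡1 ∷ m≡1s) =
    trans (cong₂ _+_ (cong suc m≡1) (sum-dlen-2-cycles m≡1s)) (sym (*-suc 2 (length cs)))

  avoiding-bound : ∀ {S M} → IsMaxCCLength0 P S M →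
                   ∀ cs → AllPairs (Disjoint P) cs → All (Avoids S) cs → sum (map (dlen P) cs) ≤ M
  avoiding-bound _                    []       _    _     = z≤n
  avoiding-bound (inj₁ (_ , none))    (c ∷ cs) disj avoid =
    contradiction (record { c₀ = c ; cs = cs ; disj = disj ; avoid = avoid }) none
  avoiding-bound (inj₂ (_ , maximal)) (c ∷ cs) disj avoid =
    maximal (record { c₀ = c ; cs = cs ; disj = disj ; avoid = avoid })

module _ {n : ℕ} {P : SignPattern n} (C : GCycle P) where

  open GCycle C using (m; vert)

  private
    around : ℕ → Fin n
    around k = vert (k mod suc m)

    toℕ-mod : ∀ {k} → k < suc m → toℕ (k mod suc m) ≡ k
    toℕ-mod k<1+m = trans (toℕ-fromℕ< _) (m<n⇒m%n≡m k<1+m)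

    around-toℕ : ∀ a → around (toℕ a) ≡ vert a
    around-toℕ a = cong vert (toℕ-injective (toℕ-mod (toℕ<n a)))

    around-adj : ∀ {k} → k < m → Adj P (around k) (around (suc k))
    around-adj {k} k<m with toℕ-next (k mod suc m)
    ... | inj₁ (k≡m , _) = contradiction (trans (sym (toℕ-mod (m<n⇒m<1+n k<m))) k≡m) (<⇒≢ k<m)
    ... | inj₂ (_ , next≡) = subst (Adj P (around k) ∘ vert) next≡suc (GCycle.adj C (k mod suc m))
      where
        next≡suc : next (k mod suc m) ≡ suc k mod suc m
        next≡suc = toℕ-injective
          (trans next≡ (trans (cong suc (toℕ-mod (m<n⇒m<1+n k<m))) (sym (toℕ-mod (s≤s k<m)))))

    around-inj : ∀ {k l} → k ≤ m → l ≤ m → around k ≡ around l → k ≡ l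
    around-inj k≤m l≤m eq =
      trans (sym (toℕ-mod (s≤s k≤m))) (trans (cong toℕ (GCycle.inj C eq)) (toℕ-mod (s≤s l≤m)))

    arc : ∀ α β → toℕ α ≤ toℕ β → PathBetween P (vert α) (vert β) (OnCycle P C)
    arc α β α≤β = record
      { path   = record { len = L ; vertex = around ∘ (toℕ α +_) ; adjacent = arc-adj ; injective = arc-inj }
      ; starts = trans (cong around (+-identityʳ (toℕ α))) (around-toℕ α)
      ; ends   = trans (cong around α+L≡β) (around-toℕ β)
      ; within = λ { (k , _ , refl) → _ , refl } }
      where
        L = toℕ β ∸ toℕ α
        α+L≡β : toℕ α + L ≡ toℕ β
        α+L≡β = m+[n∸m]≡n α≤β
        in-range : ∀ {k} → k ≤ L → toℕ α + k ≤ m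
        in-range k≤L = ≤-trans (+-monoʳ-≤ (toℕ α) k≤L) (subst (_≤ m) (sym α+L≡β) (toℕ≤pred[n] β))
        arc-adj : ∀ {k} → k < L → Adj P (around (toℕ α + k)) (around (toℕ α + suc k))
        arc-adj {k} k<L = subst (Adj P (around (toℕ α + k)) ∘ around) (sym (+-suc (toℕ α) k))
                                (around-adj (subst (_≤ m) (+-suc (toℕ α) k) (in-range k<L)))
        arc-inj : ∀ {i j} → i ≤ L → j ≤ L → around (toℕ α + i) ≡ around (toℕ α + j) → i ≡ j
        arc-inj i≤L j≤L eq = +-cancelˡ-≡ (toℕ α) _ _ (around-inj (in-range i≤L) (in-range j≤L) eq)

  onCycle? : ∀ v → Dec (OnCycle P C v)
  onCycle? v = any? λ i → vert i ≟ᶠ v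

  cycleArc : CombSymmetric P → ∀ {a b} → OnCycle P C a → OnCycle P C b → PathBetween P a b (OnCycle P C)
  cycleArc csym (α , refl) (β , refl) with toℕ α ≤? toℕ β
  ... | yes α≤β = arc α β α≤β
  ... | no α≰β = PathBetween-sym csym (arc β α (<⇒≤ (≰⇒> α≰β)))

  lower-bound : ∀ {M} → IsMaxCCLength0 P (OnCycle P C) M →
                Σ (CompositeCycle P) λ cc → ccLength P cc ≡ glen P C + M
  lower-bound (inj₁ (M≡0 , _)) =
    record { c₀ = GCycle→DCycle C ; cs = [] ; disj = [] ∷ [] ; avoid = (λ _ ()) ∷ [] } ,
    cong (glen P C +_) (sym M≡0)
  lower-bound (inj₂ ((cc , len≡M) , _)) =
    record { c₀ = GCycle→DCycle C ; cs = c₀ ∷ cs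
           ; disj = All.map (λ {d} → C-disjoint {d}) avoid ∷ disj ; avoid = All.universal (λ _ _ ()) _ } ,
    cong (glen P C +_) len≡M
    where
      open CompositeCycleAvoiding cc
      C-disjoint : ∀ {d : DCycle P} → Avoids (OnCycle P C) d → Disjoint P (GCycle→DCycle C) d
      C-disjoint avoids i j eq = avoids j (i , eq)

module _ {n : ℕ} {P : SignPattern n} (C : GCycle P) (uc : UniqueCycle P C) where

  closedPath⊆C : (p : Path P) → 2 ≤ len p → Adj P (end p) (start p) → ∀ {v} → v ∈ᵥ p → OnCycle P C v
  closedPath⊆C p 2≤len end~start (i , i≤len , refl) =
    subst (OnCycle P C ∘ vertex p) (toℕ-fromℕ< (s≤s i≤len))
          (edges⊆⇒vertices⊆ C′ C (λ x y → proj₁ (uc C′ x y)) (fromℕ< (s≤s i≤len)))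
    where C′ = closedPath→GCycle p 2≤len end~start

  module _ (c : DCycle P) (2≤m : 2 ≤ DCycle.m c) where

    private
      c′ = DCycle→GCycle c 2≤m

    longDCycle⊆C : ∀ i → OnCycle P C (DCycle.vert c i)
    longDCycle⊆C = edges⊆⇒vertices⊆ c′ C (λ x y → proj₁ (uc c′ x y))

    C⊆longDCycle : ∀ j → ∃[ i ] DCycle.vert c i ≡ GCycle.vert C j
    C⊆longDCycle = edges⊆⇒vertices⊆ C c′ (λ x y → proj₂ (uc c′ x y))

    longDCycle-dlen≤glen : dlen P c ≤ glen P C
    longDCycle-dlen≤glen = injective⇒≤ λ {i} {i′} eq →
      DCycle.inj c (trans (sym (proj₂ (longDCycle⊆C i)))
                          (trans (cong (GCycle.vert C) eq) (proj₂ (longDCycle⊆C i′))))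

  long-cycle-bound : ∀ {M} → IsMaxCCLength0 P (OnCycle P C) M →
                     ∀ {cs} → AllPairs (Disjoint P) cs → Any (λ c → 2 ≤ DCycle.m c) cs →
                     sum (map (dlen P) cs) ≤ glen P C + M
  long-cycle-bound max {cs} disj long =
    subst (_≤ glen P C + _) (sym (sum-map-─ (dlen P) long))
      (+-mono-≤ (longDCycle-dlen≤glen c 2≤m)
                (avoiding-bound max (cs ─ long) (AllPairs-─⁺ long disj)
                                (All.map (λ {d} → avoids-C {d}) c-disjoint)))
    where
      c   = Any.lookup long
      2≤m = lookup-result long
      c-disjoint = AllPairs⇒All-lookup-─ (λ {c} {d} → Disjoint-sym {c = c} {d}) long disj
      avoids-C : ∀ {d : DCycle P} → Disjoint P c d → Avoids (OnCycle P C) d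
      avoids-C c∩d=∅ i (j , vj≡) with k , ck≡vj ← C⊆longDCycle c 2≤m j = c∩d=∅ k i (trans ck≡vj vj≡)

module Depth {n : ℕ} {P : SignPattern n} (irr : Irreducible P) (C : GCycle P) where

  WalkToCycle : Fin n → ℕ → Set
  WalkToCycle v l = ∃[ i ] Walk P v (GCycle.vert C i) l

  private
    walk-length-0 : ∀ {u v} → Walk P u v 0 → u ≡ v
    walk-length-0 here = refl

    walkToCycle? : ∀ v l → Dec (WalkToCycle v l)
    walkToCycle? v zero =
      map′ (λ (i , v≡) → i , subst (λ u → Walk P v u 0) v≡ here) (λ (i , walk) → i , walk-length-0 walk)
           (any? λ i → v ≟ᶠ GCycle.vert C i)
    walkToCycle? v (suc l) =
      map′ (λ (w , v~w , i , walk) → i , step v~w walk) (λ { (i , step v~w walk) → _ , v~w , i , walk })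
           (any? λ w → adj? P v w ×-dec walkToCycle? w l)

    shortest : ∀ v → ∃[ d ] WalkToCycle v d × (∀ {l} → WalkToCycle v l → d ≤ l)
    shortest v = least-witness (walkToCycle? v) (fzero , proj₂ (irr v (GCycle.vert C fzero)))

  depth : Fin n → ℕ
  depth v = proj₁ (shortest v)

  depth-walk : ∀ v → WalkToCycle v (depth v)
  depth-walk v = proj₁ (proj₂ (shortest v))

  depth-minimal : ∀ {v l} → WalkToCycle v l → depth v ≤ l
  depth-minimal {v} = proj₂ (proj₂ (shortest v))

  depth-dist : ∀ v → DistToCycle P C v (depth v)
  depth-dist v = depth-walk v , λ i l walk → depth-minimal (i , walk)

  OnCycle⇒depth≡0 : ∀ {v} → OnCycle P C v → depth v ≡ 0
  OnCycle⇒depth≡0 (i , refl) = n≤0⇒n≡0 (depth-minimal (i , here))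

  depth≡0⇒OnCycle : ∀ {v} → depth v ≡ 0 → OnCycle P C v
  depth≡0⇒OnCycle {v} d≡0 with i , walk ← subst (WalkToCycle v) d≡0 (depth-walk v) =
    i , sym (walk-length-0 walk)

  depth-adj : ∀ {x y} → Adj P x y → depth x ≤ suc (depth y)
  depth-adj {y = y} x~y with i , walk ← depth-walk y = depth-minimal (i , step x~y walk)

  private
    parentOf : ∀ v → ∃[ w ] (1 ≤ depth v → Adj P v w) × depth w ≡ pred (depth v)
    parentOf v = first-step (depth v) (depth-walk v) refl
      where
        first-step : ∀ l → WalkToCycle v l → depth v ≡ l →
                     ∃[ w ] (1 ≤ depth v → Adj P v w) × depth w ≡ pred (depth v)
        first-step zero _ d≡0 =
          v , (λ 1≤d → contradiction (subst (1 ≤_) d≡0 1≤d) λ ()) , trans d≡0 (cong pred (sym d≡0))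
        first-step (suc l) (i , step {w = w} v~w walk) d≡1+l =
          w , const v~w , trans (≤-antisym (depth-minimal (i , walk)) l≤dw) (cong pred (sym d≡1+l))
          where l≤dw = s≤s⁻¹ (subst (_≤ suc (depth w)) d≡1+l (depth-adj v~w))

  parent : Fin n → Fin n
  parent v = proj₁ (parentOf v)

  parent-adj : ∀ {v} → 1 ≤ depth v → Adj P v (parent v)
  parent-adj {v} = proj₁ (proj₂ (parentOf v))

  depth-parent : ∀ v → depth (parent v) ≡ pred (depth v)
  depth-parent v = proj₂ (proj₂ (parentOf v))

  ancestor : ℕ → Fin n → Fin n
  ancestor zero    v = v
  ancestor (suc i) v = parent (ancestor i v)

  depth-ancestor : ∀ i v → depth (ancestor i v) ≡ depth v ∸ i
  depth-ancestor zero    v = refl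
  depth-ancestor (suc i) v =
    trans (depth-parent (ancestor i v))
          (trans (cong pred (depth-ancestor i v)) (pred[m∸n]≡m∸[1+n] (depth v) i))

  ancestor-depth : ∀ {v e} i → depth v ≡ e → depth (ancestor i v) ≡ e ∸ i
  ancestor-depth {v} i dv = trans (depth-ancestor i v) (cong (_∸ i) dv)

  descent : ∀ v k → k ≤ depth v → Path P
  descent v k k≤d = record
    { len       = k
    ; vertex    = λ i → ancestor i v
    ; adjacent  = λ {i} i<k →
                    parent-adj (subst (1 ≤_) (sym (depth-ancestor i v)) (m<n⇒0<n∸m (≤-trans i<k k≤d)))
    ; injective = λ {i} {j} i≤k j≤k eq → ∸-cancelˡ-≡ (≤-trans i≤k k≤d) (≤-trans j≤k k≤d)
                    (trans (sym (depth-ancestor i v)) (trans (cong depth eq) (depth-ancestor j v))) }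

module Forest {n : ℕ} {P : SignPattern n} (irr : Irreducible P) (csym : CombSymmetric P)
              (C : GCycle P) (uc : UniqueCycle P C) where

  open Depth irr C public
  open PathBetween

  ShallowPath : Fin n → Fin n → ℕ → Set
  ShallowPath x y e = Σ (PathBetween P x y (λ v → depth v ≤ e)) λ π → 1 ≤ e → 2 ≤ len (path π)

  private
    bridge : ∀ {x y e j} → depth x ≡ e → depth y ≡ e → ancestor j x ≡ ancestor j y ⊎ j ≡ e →
             PathBetween P (ancestor j x) (ancestor j y) (λ v → depth v ≡ e ∸ j)
    bridge {x} {j = j} dx _ (inj₁ joined) = record
      { path = point (ancestor j x) ; starts = refl ; ends = joined
      ; within = λ { (_ , _ , refl) → ancestor-depth j dx } }
    bridge {x} {y} {e} dx dy (inj₂ refl) = record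
      { path = path π ; starts = starts π ; ends = ends π
      ; within = λ v∈π → trans (OnCycle⇒depth≡0 (within π v∈π)) (sym (n∸n≡0 e)) }
      where
        root-on-C : ∀ {v} → depth v ≡ e → OnCycle P C (ancestor e v)
        root-on-C dv = depth≡0⇒OnCycle (trans (ancestor-depth e dv) (n∸n≡0 e))
        π = cycleArc C csym (root-on-C dx) (root-on-C dy)

    -- Climb from x and y to the first level j at which their ancestors meet, or to C (j = e), and join
    -- the two ancestors there by a trivial path or an arc of C; depths keep the three pieces apart.
    module Climb {x y e} (j : ℕ) (x≢y : x ≢ y) (dx : depth x ≡ e) (dy : depth y ≡ e) (j≤e : j ≤ e)
                 (apart : ∀ {i} → i < j → ancestor i x ≢ ancestor i y)
                 (joined : ancestor j x ≡ ancestor j y ⊎ j ≡ e) where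
      ≤e : ∀ {d} i → d ≡ e ∸ i → d ≤ e
      ≤e i d≡ = subst (_≤ e) (sym d≡) (m∸n≤m e i)

      same-level : ∀ {v w i k} → depth v ≡ e → depth w ≡ e → i ≤ e → k ≤ e →
                   ancestor i v ≡ ancestor k w → i ≡ k
      same-level {i = i} {k} dv dw i≤e k≤e eq =
        ∸-cancelˡ-≡ i≤e k≤e (trans (sym (ancestor-depth i dv)) (trans (cong depth eq) (ancestor-depth k dw)))

      up     = descent x j (subst (j ≤_) (sym dx) j≤e)
      β      = bridge dx dy joined
      down-y = descent y j (subst (j ≤_) (sym dy) j≤e)
      down   = reverse csym down-y

      up-meets-β : ∀ {t} → t ≤ len (path β) → vertex (path β) t ∈ᵥ up → t ≡ 0
      up-meets-β t≤ (i , i≤j , anc≡βt) =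
        injective (path β) t≤ z≤n (trans (sym anc≡βt) (trans (cong (λ k → ancestor k x) i≡j) (sym (starts β))))
        where
          i≡j = ∸-cancelˡ-≡ (≤-trans i≤j j≤e) j≤e
                  (trans (sym (ancestor-depth i dx)) (trans (cong depth anc≡βt) (within β (_ , t≤ , refl))))

      upβ-glue = sym (starts β)
      upβ      = join up (path β) upβ-glue up-meets-β
      upβ-∈ᵥ   = join-∈ᵥ up (path β) upβ-glue up-meets-β

      upβ-meets-down : ∀ {t} → t ≤ j → vertex down t ∈ᵥ upβ → t ≡ 0
      upβ-meets-down {t} t≤j v∈upβ with upβ-∈ᵥ v∈upβ
      ... | inj₂ (k , k≤ , βk≡) = ∸-cancelˡ-≡ t≤j z≤n (sym j≡j∸t)
        where
          j≡j∸t = ∸-cancelˡ-≡ j≤e (≤-trans (m∸n≤m j t) j≤e)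
                    (trans (sym (within β (k , k≤ , refl))) (trans (cong depth βk≡) (ancestor-depth (j ∸ t) dy)))
      ... | inj₁ (i , i≤j , anc≡) with t
      ...   | zero   = refl
      ...   | suc t′ = contradiction (subst (λ k → ancestor k x ≡ _) i≡j∸t anc≡) (apart (∸-monoʳ-< z<s t≤j))
        where i≡j∸t = same-level dx dy (≤-trans i≤j j≤e) (≤-trans (m∸n≤m j (suc t′)) j≤e) anc≡

      γ-glue = trans (join-end up (path β) upβ-glue up-meets-β) (ends β)
      γ      = join upβ down γ-glue upβ-meets-down

      γ-starts : start γ ≡ x
      γ-starts =
        trans (join-start upβ down γ-glue upβ-meets-down) (join-start up (path β) upβ-glue up-meets-β)

      γ-ends : end γ ≡ y
      γ-ends = trans (join-end upβ down γ-glue upβ-meets-down) (reverse-end csym down-y)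

      γ-within : ∀ {v} → v ∈ᵥ γ → depth v ≤ e
      γ-within v∈γ with join-∈ᵥ upβ down γ-glue upβ-meets-down v∈γ
      ... | inj₂ v∈down with i , _ , refl ← reverse-∈ᵥ csym {down-y} v∈down = ≤e i (ancestor-depth i dy)
      ... | inj₁ v∈upβ with upβ-∈ᵥ v∈upβ
      ...   | inj₁ (i , _ , refl) = ≤e i (ancestor-depth i dx)
      ...   | inj₂ v∈β = ≤e j (within β v∈β)

      1≤j : 1 ≤ e → 1 ≤ j
      1≤j 1≤e = ≤∧≢⇒< z≤n λ 0≡j →
        case-0 (subst (λ k → ancestor k x ≡ ancestor k y ⊎ k ≡ e) (sym 0≡j) joined)
        where
          case-0 : x ≡ y ⊎ 0 ≡ e → ⊥
          case-0 (inj₁ x≡y) = x≢y x≡y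
          case-0 (inj₂ 0≡e) = contradiction (subst (1 ≤_) (sym 0≡e) 1≤e) λ ()

      γ-long : 1 ≤ e → 2 ≤ len γ
      γ-long 1≤e = +-mono-≤ (≤-trans (1≤j 1≤e) (m≤m+n j _)) (1≤j 1≤e)

      shallowPath : ShallowPath x y e
      shallowPath = record { path = γ ; starts = γ-starts ; ends = γ-ends ; within = γ-within } , γ-long

  connect : ∀ {x y e} → x ≢ y → depth x ≡ e → depth y ≡ e → ShallowPath x y e
  connect {x} {y} {e} x≢y dx dy
    with j , joined , first ←
           least-witness (λ j → (ancestor j x ≟ᶠ ancestor j y) ⊎-dec (j ≟ e)) (inj₂ refl) =
    Climb.shallowPath j x≢y dx dy (first (inj₂ refl)) (λ i<j eq → <⇒≱ i<j (first (inj₁ eq))) joined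

  adjacent-same-depth⇒depth≡0 : ∀ {x y} → Adj P x y → depth x ≡ depth y → depth x ≡ 0
  adjacent-same-depth⇒depth≡0 {x} {y} x~y dx≡dy with depth x in dx
  ... | zero  = refl
  ... | suc e = contradiction (OnCycle⇒depth≡0 x-on-C) (λ d≡0 → 1+n≢0 (trans (sym dx) d≡0))
    where
      shallow = connect (proj₁ x~y) dx (sym dx≡dy)
      π = proj₁ shallow
      x-on-C = closedPath⊆C C uc (path π) (proj₂ shallow (s≤s z≤n))
                 (subst₂ (Adj P) (sym (ends π)) (sym (starts π)) (adj-sym csym x~y))
                 (subst (_∈ᵥ path π) (starts π) (start∈ᵥ (path π)))

  -- For x ≢ y, a path from x to y followed by the edges y z and z x would be a cycle through z ∉ C.
  lower-neighbour-unique : ∀ {x y z e} → Adj P z x → Adj P z y →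
                           depth x ≡ e → depth y ≡ e → depth z ≡ suc e → x ≡ y
  lower-neighbour-unique {x} {y} {z} {e} z~x z~y dx dy dz with x ≟ᶠ y
  ... | yes x≡y = x≡y
  ... | no x≢y = contradiction (OnCycle⇒depth≡0 z-on-C) (λ d≡0 → 1+n≢0 (trans (sym dz) d≡0))
    where
      π = proj₁ (connect x≢y dx dy)
      to-z = edge {P = P} (adj-sym csym z~y)
      z-only-at-end : ∀ {t} → t ≤ 1 → vertex to-z t ∈ᵥ path π → t ≡ 0
      z-only-at-end z≤n       _   = refl
      z-only-at-end (s≤s z≤n) z∈π = contradiction (subst (_≤ e) dz (within π z∈π)) 1+n≰n
      γ        = join (path π) to-z (ends π) z-only-at-end
      γ-starts = trans (join-start (path π) to-z (ends π) z-only-at-end) (starts π)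
      γ-ends   = join-end (path π) to-z (ends π) z-only-at-end
      1≤len-π  = start≢end⇒1≤len (path π) λ eq → x≢y (trans (sym (starts π)) (trans eq (ends π)))
      z-on-C   = closedPath⊆C C uc γ (+-monoˡ-≤ 1 1≤len-π) (subst₂ (Adj P) (sym γ-ends) (sym γ-starts) z~x)
                   (subst (_∈ᵥ γ) γ-ends (end∈ᵥ γ))

  neighbour-depth : ∀ {x y} → Adj P x y →
                    depth y ≡ depth x ⊎ depth x ≡ suc (depth y) ⊎ depth y ≡ suc (depth x)
  neighbour-depth {x} {y} x~y with <-cmp (depth x) (depth y)
  ... | tri≈ _ dx≡dy _ = inj₁ (sym dx≡dy)
  ... | tri< dx<dy _ _ = inj₂ (inj₂ (≤-antisym (depth-adj (adj-sym csym x~y)) dx<dy))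
  ... | tri> _ _ dy<dx = inj₂ (inj₁ (≤-antisym (depth-adj x~y) dy<dx))

  non-parent-neighbour-depth : ∀ {v w} → 1 ≤ depth v → Adj P v w → w ≢ parent v → depth w ≡ suc (depth v)
  non-parent-neighbour-depth {v} {w} 1≤dv v~w w≢parent with neighbour-depth v~w
  ... | inj₁ dw≡dv = contradiction (adjacent-same-depth⇒depth≡0 v~w (sym dw≡dv)) (≢-sym (<⇒≢ 1≤dv))
  ... | inj₂ (inj₁ dv≡1+dw) = contradiction
          (lower-neighbour-unique (parent-adj 1≤dv) v~w (depth-parent v) dw≡ (trans dv≡1+dw (cong suc dw≡)))
          (w≢parent ∘ sym)
    where dw≡ = cong pred (sym dv≡1+dw)
  ... | inj₂ (inj₂ dw≡1+dv) = dw≡1+dv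

module Matching {n : ℕ} {P : SignPattern n} (irr : Irreducible P) (csym : CombSymmetric P)
                (C : GCycle P) (uc : UniqueCycle P C)
                (leaf-even : ∀ v → Leaf P v → ∀ d → DistToCycle P C v d → 2 ∣ d) where

  open Forest irr csym C uc

  -- A record rather than ¬ 2 ∣ depth v, so that v can be inferred from a proof of Odd v.
  record Odd (v : Fin n) : Set where
    constructor odd
    field 2∤depth : ¬ 2 ∣ depth v

  odd? : ∀ v → Dec (Odd v)
  odd? v = map′ odd Odd.2∤depth (¬? (2 ∣? depth v))

  Odd⇒1≤depth : ∀ {v} → Odd v → 1 ≤ depth v
  Odd⇒1≤depth (odd 2∤d) = n≢0⇒n>0 λ d≡0 → 2∤d (subst (2 ∣_) (sym d≡0) (2 ∣0))

  Odd⇒off-C : ∀ {v} → Odd v → ¬ OnCycle P C v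
  Odd⇒off-C odd-v v-on-C = contradiction (OnCycle⇒depth≡0 v-on-C) (≢-sym (<⇒≢ (Odd⇒1≤depth odd-v)))

  consecutive-odd : ∀ {u w} → depth u ≡ suc (depth w) → Odd u ⊎ Odd w
  consecutive-odd {u} {w} du≡ with 2 ∣? depth w
  ... | yes 2∣dw = inj₁ (odd λ 2∣du → 2∣n⇒2∤1+n 2∣dw (subst (2 ∣_) du≡ 2∣du))
  ... | no 2∤dw = inj₂ (odd 2∤dw)

  edge-class : ∀ {a b} → Adj P a b → (OnCycle P C a × OnCycle P C b) ⊎ Odd a ⊎ Odd b
  edge-class a~b with neighbour-depth a~b
  ... | inj₁ db≡da = inj₁ (depth≡0⇒OnCycle da≡0 , depth≡0⇒OnCycle (trans db≡da da≡0))
    where da≡0 = adjacent-same-depth⇒depth≡0 a~b (sym db≡da)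
  ... | inj₂ (inj₁ da≡1+db) = inj₂ (consecutive-odd da≡1+db)
  ... | inj₂ (inj₂ db≡1+da) = inj₂ (swap (consecutive-odd db≡1+da))

  odd-child : ∀ {v} → Odd v → ∃[ w ] Adj P v w × depth w ≡ suc (depth v)
  odd-child {v} odd-v with any? (λ w → adj? P v w ×-dec ¬? (w ≟ᶠ parent v))
  ... | yes (w , v~w , w≢parent) = w , v~w , non-parent-neighbour-depth (Odd⇒1≤depth odd-v) v~w w≢parent
  ... | no no-other = contradiction (leaf-even v leaf (depth v) (depth-dist v)) (Odd.2∤depth odd-v)
    where
      leaf : Leaf P v
      leaf = parent v , parent-adj (Odd⇒1≤depth odd-v) ,
             λ w v~w → decidable-stable (w ≟ᶠ parent v) λ w≢parent → no-other (w , v~w , w≢parent)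

  childCycle : ∀ {v} → Odd v → DCycle P
  childCycle odd-v = twoCycle csym (proj₁ (proj₂ (odd-child odd-v)))

  childCycle-disjoint : ∀ {v w} (odd-v : Odd v) (odd-w : Odd w) → v ≢ w →
                        Disjoint P (childCycle odd-v) (childCycle odd-w)
  childCycle-disjoint {v} {w} odd-v odd-w v≢w = disjoint
    where
      v~cv = proj₁ (proj₂ (odd-child odd-v))
      w~cw = proj₁ (proj₂ (odd-child odd-w))
      dcv = proj₂ (proj₂ (odd-child odd-v))
      dcw = proj₂ (proj₂ (odd-child odd-w))
      not-child : ∀ {u x} → Odd u → Odd x → ∀ {cx} → depth cx ≡ suc (depth x) → u ≢ cx
      not-child (odd 2∤du) (odd 2∤dx) dcx refl = 2∤du (subst (2 ∣_) (sym dcx) (2∤n⇒2∣1+n _ 2∤dx))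
      disjoint : Disjoint P (childCycle odd-v) (childCycle odd-w)
      disjoint fzero        fzero        = v≢w
      disjoint fzero        (fsuc fzero) = not-child odd-v odd-w dcw
      disjoint (fsuc fzero) fzero        = not-child odd-w odd-v dcv ∘ sym
      disjoint (fsuc fzero) (fsuc fzero) cv≡cw =
        v≢w (lower-neighbour-unique (adj-sym csym v~cv) cv~w refl dw≡dv dcv)
        where
          cv~w  = subst (λ u → Adj P u w) (sym cv≡cw) (adj-sym csym w~cw)
          dw≡dv = suc-injective (trans (sym dcw) (trans (cong depth (sym cv≡cw)) dcv))

  childCycles : (vs : List (Fin n)) → All Odd vs → List (DCycle P)
  childCycles []       []             = []
  childCycles (v ∷ vs) (odd-v ∷ odds) = childCycle odd-v ∷ childCycles vs odds

  childCycles-length : ∀ vs odds → sum (map (dlen P) (childCycles vs odds)) ≡ 2 * length vs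
  childCycles-length []       []             = refl
  childCycles-length (v ∷ vs) (odd-v ∷ odds) =
    trans (cong (2 +_) (childCycles-length vs odds)) (sym (*-suc 2 (length vs)))

  childCycles-avoid : ∀ vs odds → All (Avoids (OnCycle P C)) (childCycles vs odds)
  childCycles-avoid []       []             = []
  childCycles-avoid (v ∷ vs) (odd-v ∷ odds) = avoids ∷ childCycles-avoid vs odds
    where
      avoids : Avoids (OnCycle P C) (childCycle odd-v)
      avoids fzero        = Odd⇒off-C odd-v
      avoids (fsuc fzero) child-on-C =
        1+n≢0 (trans (sym (proj₂ (proj₂ (odd-child odd-v)))) (OnCycle⇒depth≡0 child-on-C))

  childCycles-disjoint : ∀ vs odds → Unique vs → AllPairs (Disjoint P) (childCycles vs odds)
  childCycles-disjoint []       []             []              = []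
  childCycles-disjoint (v ∷ vs) (odd-v ∷ odds) (v∉vs ∷ unique) =
    apart vs odds v∉vs ∷ childCycles-disjoint vs odds unique
    where
      apart : ∀ ws odds′ → All (v ≢_) ws → All (Disjoint P (childCycle odd-v)) (childCycles ws odds′)
      apart []       []               []            = []
      apart (w ∷ ws) (odd-w ∷ odds′) (v≢w ∷ v∉ws) = childCycle-disjoint odd-v odd-w v≢w ∷ apart ws odds′ v∉ws

  oddVertices : List (Fin n)
  oddVertices = filter odd? (allFin n)

  oddVertices-bound : ∀ {M} → IsMaxCCLength0 P (OnCycle P C) M → 2 * length oddVertices ≤ M
  oddVertices-bound max =
    subst (_≤ _) (childCycles-length oddVertices odds)
      (avoiding-bound max (childCycles oddVertices odds)
        (childCycles-disjoint oddVertices odds (filter⁺ odd? (allFin⁺ n)))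
        (childCycles-avoid oddVertices odds))
    where odds = all-filter odd? (allFin n)

  -- Vertices of C weigh 1 and odd vertices 2; by edge-class every edge of G weighs at least 2.
  weight : List (Fin n) → ℕ
  weight vs = length (filter (onCycle? C) vs) + 2 * length (filter odd? vs)

  weight-++ : ∀ xs ys → weight (xs ++ ys) ≡ weight xs + weight ys
  weight-++ xs ys = begin
    length (filter (onCycle? C) (xs ++ ys)) + 2 * length (filter odd? (xs ++ ys))
      ≡⟨ cong₂ (λ a b → a + 2 * b) (length-filter-++ (onCycle? C) xs ys) (length-filter-++ odd? xs ys) ⟩
    (c xs + c ys) + 2 * (o xs + o ys)       ≡⟨ cong (c xs + c ys +_) (*-distribˡ-+ 2 (o xs) (o ys)) ⟩
    (c xs + c ys) + (2 * o xs + 2 * o ys)   ≡⟨ interchange (c xs) (c ys) (2 * o xs) (2 * o ys) ⟩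
    (c xs + 2 * o xs) + (c ys + 2 * o ys)   ∎
    where
      open ≡-Reasoning
      c o : List (Fin n) → ℕ
      c vs = length (filter (onCycle? C) vs)
      o vs = length (filter odd? vs)

  odd-weight : ∀ {v vs} → v ∈ vs → Odd v → 2 ≤ weight vs
  odd-weight {vs = vs} v∈vs odd-v =
    ≤-trans (*-monoʳ-≤ 2 (∈-length (∈-filter⁺ odd? v∈vs odd-v))) (m≤n+m _ (length (filter (onCycle? C) vs)))

  edge-weight : ∀ {a b} → Adj P a b → 2 ≤ weight (a ∷ b ∷ [])
  edge-weight {a} {b} a~b with edge-class a~b
  ... | inj₁ (a-on-C , b-on-C) =
    ≤-trans (≤-reflexive (cong length (sym (filter-all (onCycle? C) (a-on-C ∷ b-on-C ∷ []))))) (m≤m+n _ _)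
  ... | inj₂ (inj₁ odd-a) = odd-weight {vs = a ∷ b ∷ []} (here refl) odd-a
  ... | inj₂ (inj₂ odd-b) = odd-weight {vs = a ∷ b ∷ []} (there (here refl)) odd-b

  matching-weight : ∀ (cs : List (DCycle P)) → All (λ c → 1 ≤ DCycle.m c) cs →
                    2 * length cs ≤ weight (endpoints cs)
  matching-weight []       []           = z≤n
  matching-weight (c ∷ cs) (1≤m ∷ 1≤ms) = begin
    2 * suc (length cs)                         ≡⟨ *-suc 2 (length cs) ⟩
    2 + 2 * length cs                           ≤⟨ +-mono-≤ (edge-weight (DCycle-adj c 1≤m))
                                                            (matching-weight cs 1≤ms) ⟩
    weight (a ∷ b ∷ []) + weight (endpoints cs) ≡⟨ weight-++ (a ∷ b ∷ []) (endpoints cs) ⟨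
    weight (endpoints (c ∷ cs))                 ∎
    where
      open ≤-Reasoning
      a = DCycle.vert c fzero
      b = DCycle.vert c (next fzero)

  matching-bound : ∀ (cs : List (DCycle P)) → All (λ c → DCycle.m c ≡ 1) cs → AllPairs (Disjoint P) cs →
                   sum (map (dlen P) cs) ≤ glen P C + 2 * length oddVertices
  matching-bound cs m≡1 disj = begin
    sum (map (dlen P) cs)              ≡⟨ sum-dlen-2-cycles m≡1 ⟩
    2 * length cs                      ≤⟨ matching-weight cs 1≤m ⟩
    weight E                           ≤⟨ +-mono-≤ on-C-bound (*-monoʳ-≤ 2 odd-bound) ⟩
    glen P C + 2 * length oddVertices  ∎
    where
      open ≤-Reasoning
      1≤m = All.map (λ m≡1 → ≤-reflexive (sym m≡1)) m≡1
      E = endpoints cs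
      E-unique = endpoints-unique 1≤m disj
      on-C⊆ : ∀ {v} → v ∈ filter (onCycle? C) E → v ∈ tabulate (GCycle.vert C)
      on-C⊆ v∈ with _ , (i , refl) ← ∈-filter⁻ (onCycle? C) {xs = E} v∈ = ∈-tabulate⁺ {f = GCycle.vert C} i
      on-C-bound : length (filter (onCycle? C) E) ≤ glen P C
      on-C-bound = subst (length (filter (onCycle? C) E) ≤_) (length-tabulate (GCycle.vert C))
                         (Unique⇒length≤ (filter⁺ (onCycle? C) E-unique) on-C⊆)
      odd-bound : length (filter odd? E) ≤ length oddVertices
      odd-bound = Unique⇒length≤ (filter⁺ odd? E-unique)
                    λ v∈ → ∈-filter⁺ odd? (∈-allFin _) (proj₂ (∈-filter⁻ odd? {xs = E} v∈))

  upper-bound : ZeroDiagonal P → ∀ {M} → IsMaxCCLength0 P (OnCycle P C) M →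
                ∀ (cc : CompositeCycle P) → ccLength P cc ≤ glen P C + M
  upper-bound zd max record { c₀ = c₀ ; cs = cs ; disj = disj }
    with Any.any? (λ c → 2 ≤? DCycle.m c) (c₀ ∷ cs)
  ... | yes long   = long-cycle-bound C uc max disj long
  ... | no no-long =
    ≤-trans (matching-bound (c₀ ∷ cs) (All.map (λ {c} → m≡1 {c}) (¬Any⇒All¬ _ no-long)) disj)
            (+-monoʳ-≤ (glen P C) (oddVertices-bound max))
    where
      m≡1 : ∀ {c : DCycle P} → ¬ 2 ≤ DCycle.m c → DCycle.m c ≡ 1
      m≡1 {c} m≱2 = ≤-antisym (s≤s⁻¹ (≰⇒> m≱2)) (ZeroDiagonal⇒1≤m zd c)

mainTheorem17 : (n : ℕ) (P : SignPattern n) →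
    Irreducible P → CombSymmetric P → ZeroDiagonal P →
    (C : GCycle P) → UniqueCycle P C →
    (∀ v → Leaf P v → ∀ d → DistToCycle P C v d → 2 ∣ d) →
    (M : ℕ) → IsMaxCCLength0 P (OnCycle P C) M →
    IsMaxCCLength P NoVertex (glen P C + M)
mainTheorem17 n P irr csym zd C uc leaf-even M max = lower-bound C max , upper-bound zd max
  where open Matching irr csym C uc leaf-even
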